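{- Let $r > s \ge 1$ be integers, and set $\varepsilon = (r-s)/r$. Then $$R_{r,s}(k) \ge \bigg( \frac{\varepsilon (k-1)}{e} \bigg)^{\varepsilon r/2}$$ for every $k \in \mathbb{N}$.
   Context: For positive integers $r > s \ge 1$ and $k$, the set-colouring Ramsey number $R_{r,s}(k)$ is the least $n \in \mathbb{N}$ such that every colouring $\chi \colon E(K_n) \to \binom{[r]}{s}$ (each edge of $K_n$ is assigned a set of exactly $s$ colours from $[r]$) contains a monochromatic clique of size $k$, i.e. a $k$-set $S$ of vertices and a colour $i$ with $i \in \chi(e)$ for all $e \in \binom{S}{2}$. Here $e$ denotes Euler's number. -}

module Defs where

open import Data.Nat as ℕ using (ℕ; zero; suc; _∸_; _<_)
open import Data.Nat.Properties using (_!≢0)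
open import Data.Nat.Combinatorics using ()
open import Data.Nat.Base using (_!)
open import Data.Integer using (+_)
open import Data.Fin using (Fin)
open import Data.Fin.Subset using (Subset; _∈_; ∣_∣)
open import Data.Rational using (ℚ; _+_; _*_; _/_; 0ℚ; 1ℚ; _≤_)
open import Data.Product using (Σ; _×_)
open import Relation.Binary.PropositionalEquality using (_≡_; _≢_)
open import Relation.Nullary using (¬_)

-- A set-colouring of E(K_n) with s-subsets of [r]: a symmetric function on
-- pairs of vertices, assigning to each edge {i,j} (i ≢ j) a set of exactly s
-- colours from [r] = Fin r.  (Values on the diagonal i = j are irrelevant.)
record SetColouring (r s n : ℕ) : Set where
  field
    colour    : Fin n → Fin n → Subset r
    symmetric : ∀ i j → colour i j ≡ colour j i
    size      : ∀ i j → i ≢ j → ∣ colour i j ∣ ≡ s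
open SetColouring public

HasMonoClique : ∀ {r s n} → SetColouring r s n → ℕ → Set
HasMonoClique {r} {s} {n} χ k =
  Σ (Subset n) λ S → Σ (Fin r) λ c →
    (∣ S ∣ ≡ k) ×
    (∀ i j → i ∈ S → j ∈ S → i ≢ j → c ∈ colour χ i j)

Arrows : ℕ → ℕ → ℕ → ℕ → Set
Arrows r s k n = (χ : SetColouring r s n) → HasMonoClique χ k

IsSetRamseyNumber : ℕ → ℕ → ℕ → ℕ → Set
IsSetRamseyNumber r s k n = Arrows r s k n × (∀ m → m < n → ¬ Arrows r s k m)

_^ℚ_ : ℚ → ℕ → ℚ
q ^ℚ zero  = 1ℚ
q ^ℚ suc m = q * (q ^ℚ m)

ℕ→ℚ : ℕ → ℚ
ℕ→ℚ n = (+ n) / 1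

eSum : ℕ → ℚ
eSum zero    = _/_ (+ 1) (0 !) {{0 !≢0}}
eSum (suc N) = eSum N + _/_ (+ 1) (suc N !) {{suc N !≢0}}

-- q ≥ e  (e = sup_N Σ_{i≤N} 1/i!)
GeEuler : ℚ → Set
GeEuler q = ∀ N → eSum N ≤ q

module Submission where

open import Defs

-- Let t = r − s and let the vertices be words of length r over an alphabet of size k − 1 that
-- pairwise agree in fewer than t positions. Two such words differ in more than s positions;
-- colour their edge with s of them. The words in a clique monochromatic in colour c have
-- pairwise distinct letters at position c, so the clique has fewer than k vertices. At most
-- C(r,t)·(k−1)^(r−t) words agree with a given word in at least t positions, so a greedy choice finds
-- R such words whenever R·C(r,t)·(k−1)^(r−t) < (k−1)^r. Hence t!·(k−1)^t ≤ R_{r,s}(k)·r^t.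
-- The binomial theorem gives (1 + 1/j)^j ≤ Σ_{i≤j} 1/i!, so n^n ≤ n!·e^n, and therefore
-- R_{r,s}(k) ≥ (ε(k−1)/e)^(εr). Since R ≤ R², this implies the claim.

module Sums where

  open import Data.Nat
  open import Data.Nat.Properties
  open import Data.Fin using (Fin; zero; suc; punchIn)
  open import Data.Fin.Properties using (punchInᵢ≢i)
  open import Data.Product using (∃; _,_)
  open import Data.Vec.Functional using (removeAt)
  open import Relation.Binary.PropositionalEquality
  open import Relation.Nullary using (yes; no)
  open import Algebra.Properties.Semiring.Sum +-*-semiring public
  open import Algebra.Definitions.RawMonoid +-0-rawMonoid using (_×_)

  ×≡* : ∀ n x → n × x ≡ n * x
  ×≡* zero    x = refl
  ×≡* (suc n) x = cong (x +_) (×≡* n x)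

  ∑-const : ∀ n c → ∑[ i < n ] c ≡ n * c
  ∑-const n c = trans (sum-replicate n) (×≡* n c)

  ∑-mono-≤ : ∀ {n} {f g : Fin n → ℕ} → (∀ i → f i ≤ g i) → sum f ≤ sum g
  ∑-mono-≤ {zero}  f≤g = z≤n
  ∑-mono-≤ {suc n} f≤g = +-mono-≤ (f≤g zero) (∑-mono-≤ (λ i → f≤g (suc i)))

  ∑-≤-except : ∀ {n A B} (f : Fin n → ℕ) (x : Fin n) →
    f x ≤ A → (∀ i → i ≢ x → f i ≤ B) → sum f ≤ A + n * B
  ∑-≤-except {suc n} {A} {B} f x fx≤A fi≤B = begin
    sum f                     ≡⟨ sum-remove {i = x} f ⟩
    f x + sum (removeAt f x)  ≤⟨ +-mono-≤ fx≤A (∑-mono-≤ (λ i → fi≤B (punchIn x i) (punchInᵢ≢i x i))) ⟩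
    A + ∑[ i < n ] B          ≡⟨ cong (A +_) (∑-const n B) ⟩
    A + n * B                 ≤⟨ +-monoʳ-≤ A (m≤n+m (n * B) B) ⟩
    A + suc n * B             ∎
    where open ≤-Reasoning

  ∑<⇒∃< : ∀ {n M} (f : Fin n → ℕ) → sum f < n * M → ∃ λ i → f i < M
  ∑<⇒∃< {suc n} {M} f ∑f<n*M with f zero <? M
  ... | yes f₀<M = zero , f₀<M
  ... | no  f₀≮M with ∑<⇒∃< (λ i → f (suc i)) (+-cancelˡ-< M _ _ (≤-<-trans (+-monoˡ-≤ _ (≮⇒≥ f₀≮M)) ∑f<n*M))
  ...   | i , fᵢ<M = suc i , fᵢ<M

module Subsets where

  open import Data.Nat using (ℕ; zero; suc; _≤_; z≤n; s≤s)
  open import Data.Bool using (true; false)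
  open import Data.Fin using (Fin; zero; suc; _≟_)
  open import Data.Fin.Properties using (injective⇒≤; suc-injective)
  open import Data.Fin.Subset using (Subset; _∈_; _⊆_; ∣_∣)
  open import Data.Vec using ([]; _∷_; here; there)
  open import Function using (_∘_)
  open import Relation.Binary.PropositionalEquality
  open import Relation.Nullary using (yes; no; contradiction)

  firstElements : ∀ {n} → ℕ → Subset n → Subset n
  firstElements t       []          = []
  firstElements zero    (_ ∷ p)     = false ∷ firstElements zero p
  firstElements (suc t) (true ∷ p)  = true ∷ firstElements t p
  firstElements (suc t) (false ∷ p) = false ∷ firstElements (suc t) p

  ∣firstElements∣ : ∀ {n} t (p : Subset n) → t ≤ ∣ p ∣ → ∣ firstElements t p ∣ ≡ t
  ∣firstElements∣ zero    []          _         = refl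
  ∣firstElements∣ zero    (_ ∷ p)     _         = ∣firstElements∣ zero p z≤n
  ∣firstElements∣ (suc t) (true ∷ p)  (s≤s t≤p) = cong suc (∣firstElements∣ t p t≤p)
  ∣firstElements∣ (suc t) (false ∷ p) t≤p       = ∣firstElements∣ (suc t) p t≤p

  firstElements-⊆ : ∀ {n} t (p : Subset n) → firstElements t p ⊆ p
  firstElements-⊆ zero    (_ ∷ p)     (there x∈) = there (firstElements-⊆ zero p x∈)
  firstElements-⊆ (suc t) (true ∷ p)  here       = here
  firstElements-⊆ (suc t) (true ∷ p)  (there x∈) = there (firstElements-⊆ t p x∈)
  firstElements-⊆ (suc t) (false ∷ p) (there x∈) = there (firstElements-⊆ (suc t) p x∈)

  enumerate : ∀ {n} (p : Subset n) → Fin ∣ p ∣ → Fin n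
  enumerate (true ∷ p)  zero    = zero
  enumerate (true ∷ p)  (suc i) = suc (enumerate p i)
  enumerate (false ∷ p) i       = suc (enumerate p i)

  enumerate-∈ : ∀ {n} (p : Subset n) i → enumerate p i ∈ p
  enumerate-∈ (true ∷ p)  zero    = here
  enumerate-∈ (true ∷ p)  (suc i) = there (enumerate-∈ p i)
  enumerate-∈ (false ∷ p) i       = there (enumerate-∈ p i)

  enumerate-injective : ∀ {n} (p : Subset n) {i j} → enumerate p i ≡ enumerate p j → i ≡ j
  enumerate-injective (true ∷ p)  {zero}  {zero}  _ = refl
  enumerate-injective (true ∷ p)  {suc i} {suc j} e = cong suc (enumerate-injective p (suc-injective e))
  enumerate-injective (false ∷ p) e                 = enumerate-injective p (suc-injective e)

  injectiveOn⇒∣p∣≤ : ∀ {n m} (p : Subset n) (h : Fin n → Fin m) →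
    (∀ {i j} → i ∈ p → j ∈ p → i ≢ j → h i ≢ h j) → ∣ p ∣ ≤ m
  injectiveOn⇒∣p∣≤ p h distinct = injective⇒≤ {f = h ∘ enumerate p} injective
    where
    injective : ∀ {i j} → h (enumerate p i) ≡ h (enumerate p j) → i ≡ j
    injective {i} {j} e with enumerate p i ≟ enumerate p j
    ... | yes same = enumerate-injective p same
    ... | no  diff = contradiction e (distinct (enumerate-∈ p i) (enumerate-∈ p j) diff)

module Codes where

  open import Data.Nat hiding (_≟_)
  open import Data.Nat.Properties hiding (_≟_)
  open import Data.Nat.Solver using (module +-*-Solver)
  open import Data.Bool using (Bool; true; false; if_then_else_; _∨_; not; T)
  open import Data.Fin using (Fin; zero; suc; _≟_)
  open import Data.Fin.Subset using (Subset; _∈_; ∣_∣)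
  open import Data.Vec using (Vec; []; _∷_; lookup; there)
  import Data.Vec.Functional as Vector
  open import Data.Product using (∃; Σ; _,_)
  open import Data.Empty using (⊥-elim)
  open import Function using (_∘_)
  open import Function.Bundles using (mk⇔)
  open import Relation.Binary.PropositionalEquality
  open import Relation.Nullary using (¬_; does; yes; no)
  open import Relation.Nullary.Decidable using (dec-true; dec-false; does-⇔)
  open Sums
  open Subsets
  open +-*-Solver

  bernoulli : ∀ r t → r ^ t * (suc t + r) ≤ suc r ^ suc t
  bernoulli r zero    = ≤-reflexive (solve 1 (λ r → con 1 :* (con 1 :+ r) := (con 1 :+ r) :* con 1) refl r)
  bernoulli r (suc t) = begin
    r ^ suc t * (suc (suc t) + r)
      ≡⟨ solve 3 (λ r rᵗ t → (r :* rᵗ) :* (con 2 :+ t :+ r) := r :* (rᵗ :* (con 1 :+ t :+ r)) :+ r :* rᵗ)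
           refl r (r ^ t) t ⟩
    r * (r ^ t * (suc t + r)) + r ^ suc t
      ≤⟨ +-mono-≤ (*-monoʳ-≤ r (bernoulli r t)) (^-monoˡ-≤ (suc t) (n≤1+n r)) ⟩
    r * suc r ^ suc t + suc r ^ suc t
      ≡⟨ +-comm (r * suc r ^ suc t) _ ⟩
    suc r ^ suc (suc t) ∎
    where open ≤-Reasoning

  module _ {a : ℕ} where

    Word : ℕ → Set
    Word = Vec (Fin a)

    count : ∀ r → (Word r → Bool) → ℕ
    count zero    P = if P [] then 1 else 0
    count (suc r) P = ∑[ i < a ] count r (λ w → P (i ∷ w))

    count-cong : ∀ r {P Q : Word r → Bool} → (∀ w → P w ≡ Q w) → count r P ≡ count r Q
    count-cong zero    P≗Q = cong (λ b → if b then 1 else 0) (P≗Q [])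
    count-cong (suc r) P≗Q = sum-cong-≗ {a} (λ i → count-cong r (λ w → P≗Q (i ∷ w)))

    count-≤ : ∀ r P → count r P ≤ a ^ r
    count-≤ zero P with P []
    ... | true  = ≤-refl
    ... | false = z≤n
    count-≤ (suc r) P = begin
      count (suc r) P     ≤⟨ ∑-mono-≤ (λ i → count-≤ r (λ w → P (i ∷ w))) ⟩
      ∑[ i < a ] (a ^ r)  ≡⟨ ∑-const a (a ^ r) ⟩
      a ^ suc r           ∎
      where open ≤-Reasoning

    count-false : ∀ r → count r (λ _ → false) ≡ 0
    count-false zero    = refl
    count-false (suc r) = begin
      ∑[ i < a ] count r (λ _ → false)  ≡⟨ sum-cong-≗ {a} (λ _ → count-false r) ⟩
      ∑[ i < a ] 0                      ≡⟨ ∑-const a 0 ⟩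
      a * 0                             ≡⟨ *-zeroʳ a ⟩
      0                                 ∎
      where open ≡-Reasoning

    count-∨ : ∀ r P Q → count r (λ w → P w ∨ Q w) ≤ count r P + count r Q
    count-∨ zero P Q with P [] | Q []
    ... | true  | _     = s≤s z≤n
    ... | false | true  = ≤-refl
    ... | false | false = z≤n
    count-∨ (suc r) P Q = begin
      count (suc r) (λ w → P w ∨ Q w)
        ≤⟨ ∑-mono-≤ (λ i → count-∨ r (λ w → P (i ∷ w)) (λ w → Q (i ∷ w))) ⟩
      ∑[ i < a ] (count r (λ w → P (i ∷ w)) + count r (λ w → Q (i ∷ w)))
        ≡⟨ ∑-distrib-+ (λ i → count r (λ w → P (i ∷ w))) _ ⟩
      count (suc r) P + count (suc r) Q ∎
      where open ≤-Reasoning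

    count<⇒∃false : ∀ r P → count r P < a ^ r → ∃ λ w → P w ≡ false
    count<⇒∃false zero P count<1 with P [] in P[]≡
    ... | false = [] , P[]≡
    ... | true  = ⊥-elim (n≮n 1 count<1)
    count<⇒∃false (suc r) P count< with ∑<⇒∃< (λ i → count r (λ w → P (i ∷ w))) count<
    ... | i , countᵢ< with count<⇒∃false r (λ w → P (i ∷ w)) countᵢ<
    ...   | w , Pw≡false = i ∷ w , Pw≡false

    ≟-sym : (x y : Fin a) → does (x ≟ y) ≡ does (y ≟ x)
    ≟-sym x y = does-⇔ (mk⇔ sym sym) (x ≟ y) (y ≟ x)

    agreements : ∀ {r} → Word r → Word r → ℕ
    agreements []       []       = 0
    agreements (x ∷ xs) (y ∷ ys) = if does (x ≟ y) then suc (agreements xs ys) else agreements xs ys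

    agreements-sym : ∀ {r} (x y : Word r) → agreements x y ≡ agreements y x
    agreements-sym []       []       = refl
    agreements-sym (x ∷ xs) (y ∷ ys) rewrite ≟-sym x y | agreements-sym xs ys = refl

    disagreements : ∀ {r} → Word r → Word r → Subset r
    disagreements []       []       = []
    disagreements (x ∷ xs) (y ∷ ys) = not (does (x ≟ y)) ∷ disagreements xs ys

    ∣disagreements∣+agreements≡r : ∀ {r} (x y : Word r) → ∣ disagreements x y ∣ + agreements x y ≡ r
    ∣disagreements∣+agreements≡r []       []       = refl
    ∣disagreements∣+agreements≡r (x ∷ xs) (y ∷ ys) with x ≟ y
    ... | yes _ = trans (+-suc _ _) (cong suc (∣disagreements∣+agreements≡r xs ys))
    ... | no  _ = cong suc (∣disagreements∣+agreements≡r xs ys)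

    disagreements-sym : ∀ {r} (x y : Word r) → disagreements x y ≡ disagreements y x
    disagreements-sym []       []       = refl
    disagreements-sym (x ∷ xs) (y ∷ ys) = cong₂ _∷_ (cong not (≟-sym x y)) (disagreements-sym xs ys)

    ∈disagreements⇒≢ : ∀ {r} (x y : Word r) {c} → c ∈ disagreements x y → lookup x c ≢ lookup y c
    ∈disagreements⇒≢ (x ∷ xs) (y ∷ ys) {zero} c∈ with x ≟ y
    ... | no x≢y = x≢y
    ∈disagreements⇒≢ (x ∷ xs) (y ∷ ys) {suc c} (there c∈) = ∈disagreements⇒≢ xs ys c∈

    -- t ≤ agreements x y, written with _<ᵇ_ so that near (suc t) reduces when the heads agree.
    near : ∀ {r} → ℕ → Word r → Word r → Bool
    near t x y = t <ᵇ suc (agreements x y)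

    near-∷-≡ : ∀ {r} t x (xs ys : Word r) → near (suc t) (x ∷ xs) (x ∷ ys) ≡ near t xs ys
    near-∷-≡ t x xs ys rewrite dec-true (x ≟ x) refl = refl

    near-∷-≢ : ∀ {r t x y} → x ≢ y → (xs ys : Word r) → near t (x ∷ xs) (y ∷ ys) ≡ near t xs ys
    near-∷-≢ {x = x} {y} x≢y xs ys rewrite dec-false (x ≟ y) x≢y = refl

    near≡false⇒agreements< : ∀ {r} t (x y : Word r) → near t x y ≡ false → agreements x y < t
    near≡false⇒agreements< t x y e = ≰⇒> (λ t≤ag → subst T e (<⇒<ᵇ (s≤s t≤ag)))

    -- C(r,t)·a^(r∸t), the union bound over the t positions of agreement.
    ballBound : ℕ → ℕ → ℕ
    ballBound r       zero    = a ^ r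
    ballBound zero    (suc t) = 0
    ballBound (suc r) (suc t) = ballBound r t + a * ballBound r (suc t)

    count-near≤ballBound : ∀ r t (x : Word r) → count r (near t x) ≤ ballBound r t
    count-near≤ballBound r       zero    x        = count-≤ r (near zero x)
    count-near≤ballBound zero    (suc t) []       = z≤n
    count-near≤ballBound (suc r) (suc t) (x ∷ xs) =
      ∑-≤-except (λ i → count r (near (suc t) (x ∷ xs) ∘ (i ∷_))) x
        (≤-trans (≤-reflexive (count-cong r (near-∷-≡ t x xs))) (count-near≤ballBound r t xs))
        (λ i i≢x → ≤-trans (≤-reflexive (count-cong r (near-∷-≢ {t = suc t} (i≢x ∘ sym) xs)))
                           (count-near≤ballBound r (suc t) xs))

    ballBound*t!*a^t≤r^t*a^r : ∀ r t → ballBound r t * t ! * a ^ t ≤ r ^ t * a ^ r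
    ballBound*t!*a^t≤r^t*a^r r       zero    =
      ≤-reflexive (solve 1 (λ x → x :* con 1 :* con 1 := con 1 :* x) refl (a ^ r))
    ballBound*t!*a^t≤r^t*a^r zero    (suc t) = z≤n
    ballBound*t!*a^t≤r^t*a^r (suc r) (suc t) = begin
      (ballBound r t + a * ballBound r (suc t)) * (suc t * t !) * (a * a ^ t)
        ≡⟨ solve 6 (λ B₀ B₁ t t! a aᵗ → (B₀ :+ a :* B₁) :* ((con 1 :+ t) :* t!) :* (a :* aᵗ)
                    := (con 1 :+ t) :* a :* (B₀ :* t! :* aᵗ) :+ a :* (B₁ :* ((con 1 :+ t) :* t!) :* (a :* aᵗ)))
             refl (ballBound r t) (ballBound r (suc t)) t (t !) a (a ^ t) ⟩
      suc t * a * (ballBound r t * t ! * a ^ t) + a * (ballBound r (suc t) * suc t ! * a ^ suc t)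
        ≤⟨ +-mono-≤ (*-monoʳ-≤ (suc t * a) (ballBound*t!*a^t≤r^t*a^r r t))
                    (*-monoʳ-≤ a (ballBound*t!*a^t≤r^t*a^r r (suc t))) ⟩
      suc t * a * (r ^ t * a ^ r) + a * (r ^ suc t * a ^ r)
        ≡⟨ solve 5 (λ t a rᵗ aʳ r → (con 1 :+ t) :* a :* (rᵗ :* aʳ) :+ a :* ((r :* rᵗ) :* aʳ)
                    := (a :* aʳ) :* (rᵗ :* (con 1 :+ t :+ r)))
             refl t a (r ^ t) (a ^ r) r ⟩
      a * a ^ r * (r ^ t * (suc t + r))  ≤⟨ *-monoʳ-≤ (a * a ^ r) (bernoulli r t) ⟩
      a * a ^ r * suc r ^ suc t          ≡⟨ *-comm (a * a ^ r) _ ⟩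
      suc r ^ suc t * a ^ suc r          ∎
      where open ≤-Reasoning

    covered : ∀ {r j} → ℕ → (Fin j → Word r) → Word r → Bool
    covered {j = zero}  t g y = false
    covered {j = suc j} t g y = near t (g zero) y ∨ covered t (g ∘ suc) y

    count-covered≤ : ∀ r t {j} (g : Fin j → Word r) → count r (covered t g) ≤ j * ballBound r t
    count-covered≤ r t {zero}  g = ≤-reflexive (count-false r)
    count-covered≤ r t {suc j} g = ≤-trans (count-∨ r (near t (g zero)) (covered t (g ∘ suc)))
      (+-mono-≤ (count-near≤ballBound r t (g zero)) (count-covered≤ r t (g ∘ suc)))

    uncovered⇒agreements< : ∀ {r j} t (g : Fin j → Word r) y → covered t g y ≡ false →
      ∀ i → agreements (g i) y < t
    uncovered⇒agreements< {j = suc j} t g y e i with near t (g zero) y in e₀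
    uncovered⇒agreements< {j = suc j} t g y e zero    | false = near≡false⇒agreements< t (g zero) y e₀
    uncovered⇒agreements< {j = suc j} t g y e (suc i) | false = uncovered⇒agreements< t (g ∘ suc) y e i

    FarApart : ∀ {r j} → ℕ → (Fin j → Word r) → Set
    FarApart t g = ∀ i j → i ≢ j → agreements (g i) (g j) < t

    uncovered-∷-farApart : ∀ {r j t} (g : Fin j → Word r) y → FarApart t g → covered t g y ≡ false →
      FarApart t (y Vector.∷ g)
    uncovered-∷-farApart g y far uncovered zero    zero    0≢0 = ⊥-elim (0≢0 refl)
    uncovered-∷-farApart {t = t} g y far uncovered zero (suc j) _ =
      subst (_< t) (agreements-sym (g j) y) (uncovered⇒agreements< t g y uncovered j)
    uncovered-∷-farApart {t = t} g y far uncovered (suc i) zero _ = uncovered⇒agreements< t g y uncovered i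
    uncovered-∷-farApart g y far uncovered (suc i) (suc j) i≢j = far i j (i≢j ∘ cong suc)

    greedyCode : ∀ r t j → j * ballBound r t < a ^ r → Σ (Fin j → Word r) (FarApart t)
    greedyCode r t zero    _     = (λ ()) , (λ ())
    greedyCode r t (suc j) bound with greedyCode r t j (≤-<-trans (m≤n+m _ _) bound)
    ... | g , far
      with count<⇒∃false r (covered t g) (≤-<-trans (count-covered≤ r t g) (≤-<-trans (m≤n+m _ _) bound))
    ...   | y , uncovered = y Vector.∷ g , uncovered-∷-farApart g y far uncovered

    Separated : ∀ {r N} → ℕ → (Fin N → Word r) → Set
    Separated s g = ∀ i j → i ≢ j → s ≤ ∣ disagreements (g i) (g j) ∣

    farApart⇒separated : ∀ {r s t N} (g : Fin N → Word r) → s + t ≤ r → FarApart t g → Separated s g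
    farApart⇒separated {r} {s} {t} g s+t≤r far i j i≢j = +-cancelʳ-≤ t s _ (begin
      s + t                                                   ≤⟨ s+t≤r ⟩
      r                                                       ≡⟨ ∣disagreements∣+agreements≡r (g i) (g j) ⟨
      ∣ disagreements (g i) (g j) ∣ + agreements (g i) (g j)  ≤⟨ +-monoʳ-≤ _ (<⇒≤ (far i j i≢j)) ⟩
      ∣ disagreements (g i) (g j) ∣ + t                       ∎)
      where open ≤-Reasoning

    codeColouring : ∀ {r s N} (g : Fin N → Word r) → Separated s g → SetColouring r s N
    codeColouring {s = s} g separated = record
      { colour    = λ i j → firstElements s (disagreements (g i) (g j))
      ; symmetric = λ i j → cong (firstElements s) (disagreements-sym (g i) (g j))
      ; size      = λ i j i≢j → ∣firstElements∣ s (disagreements (g i) (g j)) (separated i j i≢j)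
      }

    codeColouring-noMonoClique : ∀ {r s N} (g : Fin N → Word r) (separated : Separated s g) →
      ¬ HasMonoClique (codeColouring g separated) (suc a)
    codeColouring-noMonoClique {s = s} g separated (S , c , ∣S∣≡1+a , mono) =
      1+n≰n (subst (_≤ a) ∣S∣≡1+a (injectiveOn⇒∣p∣≤ S (λ i → lookup (g i) c) distinct))
      where
      distinct : ∀ {i j} → i ∈ S → j ∈ S → i ≢ j → lookup (g i) c ≢ lookup (g j) c
      distinct {i} {j} i∈S j∈S i≢j =
        ∈disagreements⇒≢ (g i) (g j) (firstElements-⊆ s _ (mono i j i∈S j∈S i≢j))

    arrows⇒a^r≤R*ballBound : ∀ {r s t R} → s + t ≤ r → Arrows r s (suc a) R → a ^ r ≤ R * ballBound r t
    arrows⇒a^r≤R*ballBound {r} {s} {t} {R} s+t≤r arrows with a ^ r ≤? R * ballBound r t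
    ... | yes a^r≤ = a^r≤
    ... | no  a^r≰ with greedyCode r t R (≰⇒> a^r≰)
    ...   | g , far =
      let separated = farApart⇒separated g s+t≤r far
      in  ⊥-elim (codeColouring-noMonoClique g separated (arrows (codeColouring g separated)))

  arrows⇒t!*a^t≤R*r^t : ∀ {a r s t R} → s + t ≤ r → Arrows r s (suc (suc a)) R → t ! * suc a ^ t ≤ R * r ^ t
  arrows⇒t!*a^t≤R*r^t {a} {r} {s} {t} {R} s+t≤r arrows = *-cancelʳ-≤ _ _ (A ^ r) {{m^n≢0 A r}} (begin
    t ! * A ^ t * A ^ r
      ≡⟨ solve 3 (λ x y z → x :* y :* z := z :* x :* y) refl (t !) (A ^ t) (A ^ r) ⟩
    A ^ r * t ! * A ^ t
      ≤⟨ *-monoˡ-≤ (A ^ t) (*-monoˡ-≤ (t !) (arrows⇒a^r≤R*ballBound s+t≤r arrows)) ⟩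
    R * ballBound r t * t ! * A ^ t
      ≡⟨ solve 4 (λ x y z w → x :* y :* z :* w := x :* (y :* z :* w)) refl R (ballBound r t) (t !) (A ^ t) ⟩
    R * (ballBound r t * t ! * A ^ t)  ≤⟨ *-monoʳ-≤ R (ballBound*t!*a^t≤r^t*a^r r t) ⟩
    R * (r ^ t * A ^ r)                ≡⟨ *-assoc R _ _ ⟨
    R * r ^ t * A ^ r                  ∎)
    where
    open ≤-Reasoning
    A : ℕ
    A = suc a

module Factorials where

  open import Data.Nat
  open import Data.Nat.Properties
  open import Data.Nat.Combinatorics using (_C_; nCk≡n!/k![n-k]!; k![n∸k]!∣n!)
  open import Data.Nat.DivMod using (m/n*n≡m)
  open import Data.Nat.Solver using (module +-*-Solver)
  open import Data.Fin using (Fin; toℕ)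
  open import Data.Fin.Properties using (toℕ≤pred[n])
  open import Relation.Binary.PropositionalEquality
  open import Algebra.Definitions.RawMonoid +-0-rawMonoid using (_×_)
  import Algebra.Properties.Semiring.Exp +-*-semiring as Semiring
  open import Algebra.Properties.CommutativeSemiring.Binomial +-*-commutativeSemiring using (theorem)
  open import Algebra.Properties.CommutativeSemigroup *-commutativeSemigroup using (x∙yz≈y∙xz)
  open Sums
  open +-*-Solver using (solve; _:*_; _:=_)

  ^≡Semiring^ : ∀ x n → x ^ n ≡ x Semiring.^ n
  ^≡Semiring^ x zero    = refl
  ^≡Semiring^ x (suc n) = cong (x *_) (^≡Semiring^ x n)

  [1+j]^j≡∑C*j^k : ∀ j → suc j ^ j ≡ ∑[ k < suc j ] ((j C toℕ k) * j ^ toℕ k)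
  [1+j]^j≡∑C*j^k j = begin
    suc j ^ j                 ≡⟨ cong (_^ j) (+-comm 1 j) ⟩
    (j + 1) ^ j               ≡⟨ ^≡Semiring^ (j + 1) j ⟩
    (j + 1) Semiring.^ j      ≡⟨ theorem j j 1 ⟩
    ∑[ k < suc j ] ((j C toℕ k) × (j Semiring.^ toℕ k * 1 Semiring.^ (j ∸ toℕ k)))
      ≡⟨ sum-cong-≗ {suc j} term ⟩
    ∑[ k < suc j ] ((j C toℕ k) * j ^ toℕ k) ∎
    where
    open ≡-Reasoning
    term : ∀ (k : Fin (suc j)) →
      (j C toℕ k) × (j Semiring.^ toℕ k * 1 Semiring.^ (j ∸ toℕ k)) ≡ (j C toℕ k) * j ^ toℕ k
    term k = begin
      (j C toℕ k) × (j Semiring.^ toℕ k * 1 Semiring.^ (j ∸ toℕ k))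
        ≡⟨ ×≡* (j C toℕ k) _ ⟩
      (j C toℕ k) * (j Semiring.^ toℕ k * 1 Semiring.^ (j ∸ toℕ k))
        ≡⟨ cong₂ (λ u v → (j C toℕ k) * (u * v)) (^≡Semiring^ j (toℕ k)) (^≡Semiring^ 1 (j ∸ toℕ k)) ⟨
      (j C toℕ k) * (j ^ toℕ k * 1 ^ (j ∸ toℕ k))
        ≡⟨ cong (λ u → (j C toℕ k) * (j ^ toℕ k * u)) (^-zeroˡ (j ∸ toℕ k)) ⟩
      (j C toℕ k) * (j ^ toℕ k * 1)
        ≡⟨ cong ((j C toℕ k) *_) (*-identityʳ (j ^ toℕ k)) ⟩
      (j C toℕ k) * j ^ toℕ k ∎

  C*!*!≡! : ∀ {n k} → k ≤ n → (n C k) * (k ! * (n ∸ k) !) ≡ n !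
  C*!*!≡! {n} {k} k≤n =
    trans (cong (_* (k ! * (n ∸ k) !)) (nCk≡n!/k![n-k]! k≤n)) (m/n*n≡m (k![n∸k]!∣n! k≤n))
    where instance _ = k !* (n ∸ k) !≢0

  C*!-suc : ∀ {j k} → k ≤ j → (suc j C suc k) * suc k ! ≡ suc j * ((j C k) * k !)
  C*!-suc {j} {k} k≤j =
    *-cancelʳ-≡ ((suc j C suc k) * suc k !) (suc j * ((j C k) * k !)) ((j ∸ k) !) {{(j ∸ k) !≢0}} (begin
      (suc j C suc k) * suc k ! * (j ∸ k) !    ≡⟨ *-assoc (suc j C suc k) _ _ ⟩
      (suc j C suc k) * (suc k ! * (j ∸ k) !)  ≡⟨ C*!*!≡! (s≤s k≤j) ⟩
      suc j * j !                              ≡⟨ cong (suc j *_) (C*!*!≡! k≤j) ⟨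
      suc j * ((j C k) * (k ! * (j ∸ k) !))    ≡⟨ cong (suc j *_) (*-assoc (j C k) _ _) ⟨
      suc j * ((j C k) * k ! * (j ∸ k) !)      ≡⟨ *-assoc (suc j) ((j C k) * k !) ((j ∸ k) !) ⟨
      suc j * ((j C k) * k !) * (j ∸ k) !      ∎)
    where open ≡-Reasoning

  -- eSum! j = Σ_{i≤j} j!/i!
  eSum! : ℕ → ℕ
  eSum! zero    = 1
  eSum! (suc j) = suc j * eSum! j + 1

  eSum!≡∑C*! : ∀ j → eSum! j ≡ ∑[ k < suc j ] ((j C toℕ k) * toℕ k !)
  eSum!≡∑C*! zero    = refl
  eSum!≡∑C*! (suc j) = begin
    suc j * eSum! j + 1                                 ≡⟨ +-comm _ 1 ⟩
    1 + suc j * eSum! j                                 ≡⟨ cong (λ e → 1 + suc j * e) (eSum!≡∑C*! j) ⟩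
    1 + suc j * ∑[ k < suc j ] ((j C toℕ k) * toℕ k !)
      ≡⟨ cong (1 +_) (*-distribˡ-sum {suc j} (suc j) (λ k → (j C toℕ k) * toℕ k !)) ⟩
    1 + ∑[ k < suc j ] (suc j * ((j C toℕ k) * toℕ k !))
      ≡⟨ cong (1 +_) (sum-cong-≗ {suc j} (λ k → C*!-suc (toℕ≤pred[n] k))) ⟨
    1 + ∑[ k < suc j ] ((suc j C suc (toℕ k)) * suc (toℕ k) !) ∎
    where open ≡-Reasoning

  [k+d]!≤k!*b^d : ∀ b k d → k + d ≤ b → (k + d) ! ≤ k ! * b ^ d
  [k+d]!≤k!*b^d b k zero    _     rewrite +-identityʳ k = ≤-reflexive (sym (*-identityʳ (k !)))
  [k+d]!≤k!*b^d b k (suc d) k+d<b rewrite +-suc k d = begin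
    suc (k + d) * (k + d) !  ≤⟨ *-mono-≤ k+d<b ([k+d]!≤k!*b^d b k d (<⇒≤ k+d<b)) ⟩
    b * (k ! * b ^ d)        ≡⟨ x∙yz≈y∙xz b (k !) (b ^ d) ⟩
    k ! * (b * b ^ d)        ∎
    where open ≤-Reasoning

  j^k*j!≤j^j*k! : ∀ {j k} → k ≤ j → j ^ k * j ! ≤ j ^ j * k !
  j^k*j!≤j^j*k! {j} {k} k≤j = begin
    j ^ k * j !                  ≡⟨ cong (λ n → j ^ k * n !) (m+[n∸m]≡n k≤j) ⟨
    j ^ k * (k + (j ∸ k)) !
      ≤⟨ *-monoʳ-≤ (j ^ k) ([k+d]!≤k!*b^d j k (j ∸ k) (≤-reflexive (m+[n∸m]≡n k≤j))) ⟩
    j ^ k * (k ! * j ^ (j ∸ k))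
      ≡⟨ solve 3 (λ a b c → a :* (b :* c) := (a :* c) :* b) refl (j ^ k) (k !) (j ^ (j ∸ k)) ⟩
    j ^ k * j ^ (j ∸ k) * k !    ≡⟨ cong (_* k !) (^-distribˡ-+-* j k (j ∸ k)) ⟨
    j ^ (k + (j ∸ k)) * k !      ≡⟨ cong (λ n → j ^ n * k !) (m+[n∸m]≡n k≤j) ⟩
    j ^ j * k !                  ∎
    where open ≤-Reasoning

  [1+j]^j*j!≤j^j*eSum! : ∀ j → suc j ^ j * j ! ≤ j ^ j * eSum! j
  [1+j]^j*j!≤j^j*eSum! j = begin
    suc j ^ j * j !
      ≡⟨ cong (_* j !) ([1+j]^j≡∑C*j^k j) ⟩
    ∑[ k < suc j ] ((j C toℕ k) * j ^ toℕ k) * j !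
      ≡⟨ *-distribʳ-sum {suc j} (j !) (λ k → (j C toℕ k) * j ^ toℕ k) ⟩
    ∑[ k < suc j ] ((j C toℕ k) * j ^ toℕ k * j !)
      ≤⟨ ∑-mono-≤ term ⟩
    ∑[ k < suc j ] (j ^ j * ((j C toℕ k) * toℕ k !))
      ≡⟨ *-distribˡ-sum {suc j} (j ^ j) (λ k → (j C toℕ k) * toℕ k !) ⟨
    j ^ j * ∑[ k < suc j ] ((j C toℕ k) * toℕ k !)
      ≡⟨ cong (j ^ j *_) (eSum!≡∑C*! j) ⟨
    j ^ j * eSum! j ∎
    where
    open ≤-Reasoning
    term : ∀ (k : Fin (suc j)) → (j C toℕ k) * j ^ toℕ k * j ! ≤ j ^ j * ((j C toℕ k) * toℕ k !)
    term k = begin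
      (j C toℕ k) * j ^ toℕ k * j !    ≡⟨ *-assoc (j C toℕ k) _ _ ⟩
      (j C toℕ k) * (j ^ toℕ k * j !)  ≤⟨ *-monoʳ-≤ (j C toℕ k) (j^k*j!≤j^j*k! (toℕ≤pred[n] k)) ⟩
      (j C toℕ k) * (j ^ j * toℕ k !)  ≡⟨ x∙yz≈y∙xz (j C toℕ k) (j ^ j) (toℕ k !) ⟩
      j ^ j * ((j C toℕ k) * toℕ k !)  ∎

module Rationals where

  open import Data.Nat as ℕ using (zero; suc; _!)
  import Data.Nat.Properties as ℕ
  open import Data.Integer as ℤ using (+_)
  import Data.Integer.Properties as ℤ
  open import Data.Rational
  open import Data.Rational.Properties
  import Data.Rational.Unnormalised as ℚᵘ
  import Data.Rational.Unnormalised.Properties as ℚᵘ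
  open import Data.Nat.Coprimality using (1-coprimeTo; sym)
  open import Relation.Binary.PropositionalEquality hiding (sym)
  import Relation.Binary.PropositionalEquality as ≡
  open import Data.Rational.Solver using (module +-*-Solver)
  open +-*-Solver using (solve; _:*_; _:=_)
  open Codes using (arrows⇒t!*a^t≤R*r^t)
  open Factorials using (eSum!; [1+j]^j*j!≤j^j*eSum!)

  ℕ→ℚ≡mkℚ : ∀ n → ℕ→ℚ n ≡ mkℚ (+ n) 0 (sym (1-coprimeTo n))
  ℕ→ℚ≡mkℚ n = normalize-coprime (sym (1-coprimeTo n))

  ℕ→ℚ-homo-* : ∀ m n → ℕ→ℚ (m ℕ.* n) ≡ ℕ→ℚ m * ℕ→ℚ n
  ℕ→ℚ-homo-* m n = trans (/-cong {+ (m ℕ.* n)} {1} {+ m ℤ.* + n} {1} (ℤ.pos-* m n) refl)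
    (cong₂ _*_ (≡.sym (ℕ→ℚ≡mkℚ m)) (≡.sym (ℕ→ℚ≡mkℚ n)))

  ℕ→ℚ-homo-+ : ∀ m n → ℕ→ℚ (m ℕ.+ n) ≡ ℕ→ℚ m + ℕ→ℚ n
  ℕ→ℚ-homo-+ m n = trans (/-cong {+ (m ℕ.+ n)} {1} {+ m ℤ.* + 1 ℤ.+ + n ℤ.* + 1} {1}
      (trans (ℤ.pos-+ m n) (≡.sym (cong₂ ℤ._+_ (ℤ.*-identityʳ (+ m)) (ℤ.*-identityʳ (+ n))))) refl)
    (cong₂ _+_ (≡.sym (ℕ→ℚ≡mkℚ m)) (≡.sym (ℕ→ℚ≡mkℚ n)))

  ℕ→ℚ-homo-^ : ∀ m n → ℕ→ℚ (m ℕ.^ n) ≡ ℕ→ℚ m ^ℚ n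
  ℕ→ℚ-homo-^ m zero    = refl
  ℕ→ℚ-homo-^ m (suc n) = trans (ℕ→ℚ-homo-* m (m ℕ.^ n)) (cong (ℕ→ℚ m *_) (ℕ→ℚ-homo-^ m n))

  ℕ→ℚ-mono-≤ : ∀ {m n} → m ℕ.≤ n → ℕ→ℚ m ≤ ℕ→ℚ n
  ℕ→ℚ-mono-≤ {m} {n} m≤n rewrite ℕ→ℚ≡mkℚ m | ℕ→ℚ≡mkℚ n = *≤* (ℤ.*-monoʳ-≤-nonNeg (+ 1) (ℤ.+≤+ m≤n))

  ℕ→ℚ-nonNeg : ∀ n → NonNegative (ℕ→ℚ n)
  ℕ→ℚ-nonNeg n = normalize-nonNeg n 1

  ℕ→ℚ-pos : ∀ n .{{_ : ℕ.NonZero n}} → Positive (ℕ→ℚ n)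
  ℕ→ℚ-pos n = normalize-pos n 1

  i/n*n≡i : ∀ i n .{{_ : ℕ.NonZero n}} → (+ i) / n * ℕ→ℚ n ≡ ℕ→ℚ i
  i/n*n≡i i (suc d) = toℚᵘ-injective (begin
    toℚᵘ ((+ i) / suc d * ℕ→ℚ (suc d))
      ≈⟨ toℚᵘ-homo-* ((+ i) / suc d) (ℕ→ℚ (suc d)) ⟩
    toℚᵘ ((+ i) / suc d) ℚᵘ.* toℚᵘ (ℕ→ℚ (suc d))
      ≈⟨ ℚᵘ.*-cong (toℚᵘ-fromℚᵘ (ℚᵘ.mkℚᵘ (+ i) d)) (toℚᵘ-fromℚᵘ (ℚᵘ.mkℚᵘ (+ suc d) 0)) ⟩
    ℚᵘ.mkℚᵘ (+ i) d ℚᵘ.* ℚᵘ.mkℚᵘ (+ suc d) 0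
      ≈⟨ ℚᵘ.*≡* (trans (ℤ.*-identityʳ (+ i ℤ.* + suc d)) (cong (λ e → + i ℤ.* + suc e) (≡.sym (ℕ.*-identityʳ d)))) ⟩
    ℚᵘ.mkℚᵘ (+ i) 0
      ≈⟨ toℚᵘ-fromℚᵘ (ℚᵘ.mkℚᵘ (+ i) 0) ⟨
    toℚᵘ (ℕ→ℚ i) ∎)
    where open import Relation.Binary.Reasoning.Setoid ℚᵘ.≃-setoid

  ^ℚ-distribʳ-* : ∀ x y n → (x * y) ^ℚ n ≡ x ^ℚ n * y ^ℚ n
  ^ℚ-distribʳ-* x y zero    = refl
  ^ℚ-distribʳ-* x y (suc n) = trans (cong ((x * y) *_) (^ℚ-distribʳ-* x y n))
    (solve 4 (λ x y a b → (x :* y) :* (a :* b) := (x :* a) :* (y :* b)) refl x y (x ^ℚ n) (y ^ℚ n))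

  ^ℚ-nonNeg : ∀ x n → .{{NonNegative x}} → NonNegative (x ^ℚ n)
  ^ℚ-nonNeg x zero    = _
  ^ℚ-nonNeg x (suc n) = nonNeg*nonNeg⇒nonNeg x (x ^ℚ n) {{^ℚ-nonNeg x n}}

  eSum*!≡eSum! : ∀ j → eSum j * ℕ→ℚ (j !) ≡ ℕ→ℚ (eSum! j)
  eSum*!≡eSum! zero    = *-identityʳ 1ℚ
  eSum*!≡eSum! (suc j) = begin
    (eSum j + 1/[1+j]!) * ℕ→ℚ (suc j !)
      ≡⟨ *-distribʳ-+ (ℕ→ℚ (suc j !)) (eSum j) 1/[1+j]! ⟩
    eSum j * ℕ→ℚ (suc j ℕ.* j !) + 1/[1+j]! * ℕ→ℚ (suc j !)
      ≡⟨ cong₂ _+_ (cong (eSum j *_) (ℕ→ℚ-homo-* (suc j) (j !))) (i/n*n≡i 1 (suc j !) {{suc j ℕ.!≢0}}) ⟩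
    eSum j * (ℕ→ℚ (suc j) * ℕ→ℚ (j !)) + 1ℚ
      ≡⟨ cong (_+ 1ℚ) (solve 3 (λ e n f → e :* (n :* f) := n :* (e :* f)) refl (eSum j) (ℕ→ℚ (suc j)) (ℕ→ℚ (j !))) ⟩
    ℕ→ℚ (suc j) * (eSum j * ℕ→ℚ (j !)) + 1ℚ  ≡⟨ cong (λ e → ℕ→ℚ (suc j) * e + 1ℚ) (eSum*!≡eSum! j) ⟩
    ℕ→ℚ (suc j) * ℕ→ℚ (eSum! j) + 1ℚ        ≡⟨ cong (_+ 1ℚ) (ℕ→ℚ-homo-* (suc j) (eSum! j)) ⟨
    ℕ→ℚ (suc j ℕ.* eSum! j) + ℕ→ℚ 1          ≡⟨ ℕ→ℚ-homo-+ (suc j ℕ.* eSum! j) 1 ⟨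
    ℕ→ℚ (eSum! (suc j))                      ∎
    where
    open ≡-Reasoning
    1/[1+j]! : ℚ
    1/[1+j]! = _/_ (+ 1) (suc j !) {{suc j ℕ.!≢0}}

  module _ {q : ℚ} (q≥e : GeEuler q) where

    private instance
      q-nonNeg : NonNegative q
      q-nonNeg = nonNegative (≤-trans (ℕ→ℚ-mono-≤ {0} {1} ℕ.z≤n) (q≥e 0))

    [1+j]^j≤j^j*q : ∀ j → ℕ→ℚ (suc j ℕ.^ j) ≤ ℕ→ℚ (j ℕ.^ j) * q
    [1+j]^j≤j^j*q j = *-cancelʳ-≤-pos (ℕ→ℚ (j !)) {{ℕ→ℚ-pos (j !) {{j ℕ.!≢0}}}} (begin
      ℕ→ℚ (suc j ℕ.^ j) * ℕ→ℚ (j !)         ≡⟨ ℕ→ℚ-homo-* (suc j ℕ.^ j) (j !) ⟨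
      ℕ→ℚ (suc j ℕ.^ j ℕ.* j !)             ≤⟨ ℕ→ℚ-mono-≤ ([1+j]^j*j!≤j^j*eSum! j) ⟩
      ℕ→ℚ (j ℕ.^ j ℕ.* eSum! j)             ≡⟨ ℕ→ℚ-homo-* (j ℕ.^ j) (eSum! j) ⟩
      ℕ→ℚ (j ℕ.^ j) * ℕ→ℚ (eSum! j)         ≡⟨ cong (ℕ→ℚ (j ℕ.^ j) *_) (eSum*!≡eSum! j) ⟨
      ℕ→ℚ (j ℕ.^ j) * (eSum j * ℕ→ℚ (j !))
        ≤⟨ *-monoˡ-≤-nonNeg (ℕ→ℚ (j ℕ.^ j)) {{ℕ→ℚ-nonNeg (j ℕ.^ j)}}
             (*-monoʳ-≤-nonNeg (ℕ→ℚ (j !)) {{ℕ→ℚ-nonNeg (j !)}} (q≥e j)) ⟩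
      ℕ→ℚ (j ℕ.^ j) * (q * ℕ→ℚ (j !))       ≡⟨ *-assoc (ℕ→ℚ (j ℕ.^ j)) q (ℕ→ℚ (j !)) ⟨
      ℕ→ℚ (j ℕ.^ j) * q * ℕ→ℚ (j !)         ∎)
      where open ≤-Reasoning

    n^n≤n!*q^n : ∀ n → ℕ→ℚ (n ℕ.^ n) ≤ ℕ→ℚ (n !) * q ^ℚ n
    n^n≤n!*q^n zero    = ≤-reflexive (≡.sym (*-identityʳ 1ℚ))
    n^n≤n!*q^n (suc n) = begin
      ℕ→ℚ (suc n ℕ.^ suc n)                   ≡⟨ ℕ→ℚ-homo-* (suc n) (suc n ℕ.^ n) ⟩
      ℕ→ℚ (suc n) * ℕ→ℚ (suc n ℕ.^ n)         ≤⟨ *-monoˡ-≤-nonNeg (ℕ→ℚ (suc n)) {{ℕ→ℚ-nonNeg (suc n)}}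
                                                   ([1+j]^j≤j^j*q n) ⟩
      ℕ→ℚ (suc n) * (ℕ→ℚ (n ℕ.^ n) * q)       ≤⟨ *-monoˡ-≤-nonNeg (ℕ→ℚ (suc n)) {{ℕ→ℚ-nonNeg (suc n)}}
                                                   (*-monoʳ-≤-nonNeg q (n^n≤n!*q^n n)) ⟩
      ℕ→ℚ (suc n) * (ℕ→ℚ (n !) * q ^ℚ n * q)
        ≡⟨ solve 4 (λ m f p x → m :* (f :* p :* x) := (m :* f) :* (x :* p)) refl (ℕ→ℚ (suc n)) (ℕ→ℚ (n !)) (q ^ℚ n) q ⟩
      ℕ→ℚ (suc n) * ℕ→ℚ (n !) * (q * q ^ℚ n)  ≡⟨ cong (_* (q * q ^ℚ n)) (ℕ→ℚ-homo-* (suc n) (n !)) ⟨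
      ℕ→ℚ (suc n !) * q ^ℚ suc n              ∎
      where open ≤-Reasoning

    t!*A^t≤R*r^t⇒[t/r*A]^t≤R*q^t : ∀ t A R r .{{_ : ℕ.NonZero r}} → t ! ℕ.* A ℕ.^ t ℕ.≤ R ℕ.* r ℕ.^ t →
      ((+ t) / r * ℕ→ℚ A) ^ℚ t ≤ ℕ→ℚ R * q ^ℚ t
    t!*A^t≤R*r^t⇒[t/r*A]^t≤R*q^t t A R r bound =
      *-cancelʳ-≤-pos (ℕ→ℚ (r ℕ.^ t)) {{ℕ→ℚ-pos (r ℕ.^ t) {{ℕ.m^n≢0 r t}}}} (begin
        x ^ℚ t * ℕ→ℚ (r ℕ.^ t)              ≡⟨ cong (x ^ℚ t *_) (ℕ→ℚ-homo-^ r t) ⟩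
        x ^ℚ t * ℕ→ℚ r ^ℚ t                 ≡⟨ ^ℚ-distribʳ-* x (ℕ→ℚ r) t ⟨
        (x * ℕ→ℚ r) ^ℚ t                    ≡⟨ cong (_^ℚ t) x*r≡t*A ⟩
        (ℕ→ℚ t * ℕ→ℚ A) ^ℚ t                ≡⟨ ^ℚ-distribʳ-* (ℕ→ℚ t) (ℕ→ℚ A) t ⟩
        ℕ→ℚ t ^ℚ t * ℕ→ℚ A ^ℚ t             ≡⟨ cong₂ _*_ (ℕ→ℚ-homo-^ t t) (ℕ→ℚ-homo-^ A t) ⟨
        ℕ→ℚ (t ℕ.^ t) * ℕ→ℚ (A ℕ.^ t)
          ≤⟨ *-monoʳ-≤-nonNeg (ℕ→ℚ (A ℕ.^ t)) {{ℕ→ℚ-nonNeg (A ℕ.^ t)}} (n^n≤n!*q^n t) ⟩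
        ℕ→ℚ (t !) * q ^ℚ t * ℕ→ℚ (A ℕ.^ t)
          ≡⟨ solve 3 (λ f p a → f :* p :* a := f :* a :* p) refl (ℕ→ℚ (t !)) (q ^ℚ t) (ℕ→ℚ (A ℕ.^ t)) ⟩
        ℕ→ℚ (t !) * ℕ→ℚ (A ℕ.^ t) * q ^ℚ t  ≡⟨ cong (_* q ^ℚ t) (ℕ→ℚ-homo-* (t !) (A ℕ.^ t)) ⟨
        ℕ→ℚ (t ! ℕ.* A ℕ.^ t) * q ^ℚ t      ≤⟨ *-monoʳ-≤-nonNeg (q ^ℚ t) {{^ℚ-nonNeg q t}} (ℕ→ℚ-mono-≤ bound) ⟩
        ℕ→ℚ (R ℕ.* r ℕ.^ t) * q ^ℚ t        ≡⟨ cong (_* q ^ℚ t) (ℕ→ℚ-homo-* R (r ℕ.^ t)) ⟩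
        ℕ→ℚ R * ℕ→ℚ (r ℕ.^ t) * q ^ℚ t
          ≡⟨ solve 3 (λ a b c → a :* b :* c := a :* c :* b) refl (ℕ→ℚ R) (ℕ→ℚ (r ℕ.^ t)) (q ^ℚ t) ⟩
        ℕ→ℚ R * q ^ℚ t * ℕ→ℚ (r ℕ.^ t)      ∎)
      where
      open ≤-Reasoning
      x : ℚ
      x = (+ t) / r * ℕ→ℚ A
      x*r≡t*A : x * ℕ→ℚ r ≡ ℕ→ℚ t * ℕ→ℚ A
      x*r≡t*A = trans (solve 3 (λ u a n → u :* a :* n := u :* n :* a) refl ((+ t) / r) (ℕ→ℚ A) (ℕ→ℚ r))
                      (cong (_* ℕ→ℚ A) (i/n*n≡i t r))

    [p*0]^t≤R*q^t : ∀ {t} R p → 0 ℕ.< t → (p * ℕ→ℚ 0) ^ℚ t ≤ ℕ→ℚ R * q ^ℚ t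
    [p*0]^t≤R*q^t {suc t} R p _ = begin
      p * 0ℚ * (p * 0ℚ) ^ℚ t  ≡⟨ cong (λ z → z * z ^ℚ t) (*-zeroʳ p) ⟩
      0ℚ * 0ℚ ^ℚ t            ≡⟨ *-zeroˡ (0ℚ ^ℚ t) ⟩
      0ℚ                      ≤⟨ nonNegative⁻¹ _ {{R*q^t-nonNeg}} ⟩
      ℕ→ℚ R * q ^ℚ suc t      ∎
      where
      open ≤-Reasoning
      R*q^t-nonNeg : NonNegative (ℕ→ℚ R * q ^ℚ suc t)
      R*q^t-nonNeg = nonNeg*nonNeg⇒nonNeg (ℕ→ℚ R) {{ℕ→ℚ-nonNeg R}} (q ^ℚ suc t) {{^ℚ-nonNeg q (suc t)}}

    ramseyLowerBound : ∀ {r s k R} .{{_ : ℕ.NonZero r}} → s ℕ.< r → Arrows r s k R →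
      ((+ (r ℕ.∸ s)) / r * ℕ→ℚ (k ℕ.∸ 1)) ^ℚ (r ℕ.∸ s) ≤ ℕ→ℚ R * q ^ℚ (r ℕ.∸ s)
    ramseyLowerBound {r} {s} {zero}        {R} s<r _      = [p*0]^t≤R*q^t R ((+ (r ℕ.∸ s)) / r) (ℕ.m<n⇒0<n∸m s<r)
    ramseyLowerBound {r} {s} {suc zero}    {R} s<r _      = [p*0]^t≤R*q^t R ((+ (r ℕ.∸ s)) / r) (ℕ.m<n⇒0<n∸m s<r)
    ramseyLowerBound {r} {s} {suc (suc a)} {R} s<r arrows =
      t!*A^t≤R*r^t⇒[t/r*A]^t≤R*q^t (r ℕ.∸ s) (suc a) R r
        (arrows⇒t!*a^t≤R*r^t (ℕ.≤-reflexive (ℕ.m+[n∸m]≡n (ℕ.<⇒≤ s<r))) arrows)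

    R*q^t≤R*R*q^t : ∀ R t → ℕ→ℚ R * q ^ℚ t ≤ (ℕ→ℚ R * ℕ→ℚ R) * q ^ℚ t
    R*q^t≤R*R*q^t R t = *-monoʳ-≤-nonNeg (q ^ℚ t) {{^ℚ-nonNeg q t}}
      (≤-trans (ℕ→ℚ-mono-≤ (n≤n*n R)) (≤-reflexive (ℕ→ℚ-homo-* R R)))
      where
      n≤n*n : ∀ n → n ℕ.≤ n ℕ.* n
      n≤n*n zero    = ℕ.z≤n
      n≤n*n (suc n) = ℕ.m≤m*n (suc n) (suc n)

open import Data.Nat using (ℕ; _<_; _≤_; _∸_; NonZero)
open import Data.Integer using (+_)
open import Data.Rational using (ℚ; _*_; _/_)
open import Data.Rational as ℚ using ()
open import Data.Rational.Properties as ℚ using ()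
open import Data.Product using (_,_)
open Rationals using (ramseyLowerBound; R*q^t≤R*R*q^t)

theorem4p1 : (r s k R : ℕ) → 1 ≤ s → s < r → .{{_ : NonZero r}} →
    IsSetRamseyNumber r s k R →
    (q : ℚ) → GeEuler q →
    (((+ (r ∸ s)) / r) * ℕ→ℚ (k ∸ 1)) ^ℚ (r ∸ s) ℚ.≤ (ℕ→ℚ R * ℕ→ℚ R) * (q ^ℚ (r ∸ s))
theorem4p1 r s k R _ s<r (arrows , _) q q≥e =
  ℚ.≤-trans (ramseyLowerBound q≥e s<r arrows) (R*q^t≤R*R*q^t q≥e R (r ∸ s))
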